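{- Let $G$ be a connected cubic graph with a special $1$-factor $F$, and let $X=G/F$ be equipped with a blue and red $2$-factorization in which traversing transitions are exactly the color-switching ones and non-traversing transitions exactly the color-preserving ones. Let $W$ be any spanning subgraph of $X$ in which every vertex has degree $2$ or $4$. Then $W$ is admissible if and only if every vertex of degree $2$ in $W$ is incident (in $W$) with edges of different colors.
   Context: Let $Y=G-F$. $X=G/F$ is obtained by contracting each edge $e=uv\in F$ to a vertex $x_e$; its edges are the edges of $Y$, and the four edge-ends at $x_e$ correspond to the edge-ends of $Y$ at $u$ and $v$. A transition at $x_e$ (unordered pair of distinct edge-ends) is non-traversing if both come from the same end of $e$, traversing otherwise; it is color-switching if its edge-ends lie on edges of different colors, color-preserving otherwise. $F$ is special if the graph $Y(G,F)$, whose vertices are the cycles of $Y$ with two adjacent iff joined by an edge of $F$ (a loop if an edge of $F$ is a chord of a cycle), is bipartite. $W$ is admissible if at every vertex of degree $2$ in $W$ the transition formed by its two edge-ends is traversing. -}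

module Defs where

open import Data.Nat using (ℕ)
open import Data.Bool using (Bool; true; false; not; _∧_; _∨_)
open import Data.Fin using (Fin; zero; suc; _≟_)
open import Data.Fin.Base using () renaming (zero to 0F)
open import Data.List using (List; length; filterᵇ; cartesianProduct; allFin)
open import Data.Product using (Σ; ∃; _×_; _,_; proj₁; proj₂)
open import Data.Sum using (_⊎_)
open import Relation.Nullary using (¬_)
open import Relation.Nullary.Decidable using (⌊_⌋)
open import Relation.Binary.PropositionalEquality using (_≡_; _≢_)
open import Relation.Binary.Construct.Closure.ReflexiveTransitive using (Star)
open import Function.Bundles using (_⇔_)

-- Finite multigraphs (loops and parallel edges allowed), given by
-- the two ends of each edge.  Edge-ends (half-edges) are pairs (edge, side).
record Multigraph : Set where
  field
    nV   : ℕ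
    nE   : ℕ
    ends : Fin nE → Fin 2 → Fin nV

module _ (G : Multigraph) where
  open Multigraph G

  HalfEdge : Set
  HalfEdge = Fin nE × Fin 2

  halfEdges : List HalfEdge
  halfEdges = cartesianProduct (allFin nE) (allFin 2)

  vtx : HalfEdge → Fin nV
  vtx h = ends (proj₁ h) (proj₂ h)

  countH : (HalfEdge → Bool) → ℕ
  countH p = length (filterᵇ p halfEdges)

  end0 end1 : Fin nE → Fin nV
  end0 e = ends e zero
  end1 e = ends e (suc zero)

  -- degree (loops counted twice)
  deg : Fin nV → ℕ
  deg v = countH (λ h → ⌊ vtx h ≟ v ⌋)

  Cubic : Set
  Cubic = ∀ v → deg v ≡ 3

  Adj : Fin nV → Fin nV → Set
  Adj u v = ∃ λ e → (end0 e ≡ u × end1 e ≡ v) ⊎ (end0 e ≡ v × end1 e ≡ u)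

  Connected : Set
  Connected = ∀ u v → Star Adj u v

  -- spanning subgraphs = edge subsets
  EdgeSet : Set
  EdgeSet = Fin nE → Bool

  IsOneFactor : EdgeSet → Set
  IsOneFactor F = ∀ v → countH (λ h → F (proj₁ h) ∧ ⌊ vtx h ≟ v ⌋) ≡ 1

  YAdj : EdgeSet → Fin nV → Fin nV → Set
  YAdj F u v = ∃ λ e → F e ≡ false ×
    ((end0 e ≡ u × end1 e ≡ v) ⊎ (end0 e ≡ v × end1 e ≡ u))

  SameCycle : EdgeSet → Fin nV → Fin nV → Set
  SameCycle F = Star (YAdj F)

  -- F is special: Y(G,F) is bipartite, i.e. the cycles of Y admit a
  -- 2-colouring such that every edge of F joins cycles of different colours
  -- (in particular no edge of F is a chord of a cycle of Y).
  Special : EdgeSet → Set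
  Special F = Σ (Fin nV → Bool) λ c →
    (∀ u v → SameCycle F u v → c u ≡ c v) ×
    (∀ e → F e ≡ true → c (end0 e) ≢ c (end1 e))

  -- The contraction X = G/F.  Its vertices are the edges e ∈ F (vertex x_e);
  -- its edges are the edges of Y; its edge-ends are the edge-ends of Y,
  -- an edge-end h of Y lying at x_e iff vtx h is an end of e.

  InY : EdgeSet → HalfEdge → Set
  InY F h = F (proj₁ h) ≡ false

  AtX : EdgeSet → Fin nE → HalfEdge → Set
  AtX F e h = InY F h × (vtx h ≡ end0 e ⊎ vtx h ≡ end1 e)

  atXᵇ : EdgeSet → Fin nE → HalfEdge → Bool
  atXᵇ F e h = not (F (proj₁ h)) ∧ (⌊ vtx h ≟ end0 e ⌋ ∨ ⌊ vtx h ≟ end1 e ⌋)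

  -- colouring of the edges of X: true = blue, false = red.
  IsTwoFactorization : EdgeSet → (Fin nE → Bool) → Set
  IsTwoFactorization F col = ∀ e → F e ≡ true →
    (countH (λ h → atXᵇ F e h ∧ col (proj₁ h)) ≡ 2) ×
    (countH (λ h → atXᵇ F e h ∧ not (col (proj₁ h))) ≡ 2)

  -- transitions at x_e: pairs of distinct edge-ends at x_e
  Traversing : Fin nE → HalfEdge → HalfEdge → Set
  Traversing e h₁ h₂ =
    (vtx h₁ ≡ end0 e × vtx h₂ ≡ end1 e) ⊎ (vtx h₁ ≡ end1 e × vtx h₂ ≡ end0 e)

  NonTraversing : Fin nE → HalfEdge → HalfEdge → Set
  NonTraversing e h₁ h₂ =
    (vtx h₁ ≡ end0 e × vtx h₂ ≡ end0 e) ⊎ (vtx h₁ ≡ end1 e × vtx h₂ ≡ end1 e)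

  ColorSwitching : (Fin nE → Bool) → HalfEdge → HalfEdge → Set
  ColorSwitching col h₁ h₂ = col (proj₁ h₁) ≢ col (proj₁ h₂)

  ColorPreserving : (Fin nE → Bool) → HalfEdge → HalfEdge → Set
  ColorPreserving col h₁ h₂ = col (proj₁ h₁) ≡ col (proj₁ h₂)

  Compatible : EdgeSet → (Fin nE → Bool) → Set
  Compatible F col = ∀ e → F e ≡ true → ∀ h₁ h₂ → h₁ ≢ h₂ →
    AtX F e h₁ → AtX F e h₂ →
    (Traversing e h₁ h₂ ⇔ ColorSwitching col h₁ h₂) ×
    (NonTraversing e h₁ h₂ ⇔ ColorPreserving col h₁ h₂)

  -- spanning subgraphs W of X: subsets of the edges of Y
  IsSubgraphOfX : EdgeSet → EdgeSet → Set
  IsSubgraphOfX F W = ∀ g → W g ≡ true → F g ≡ false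

  InW : EdgeSet → HalfEdge → Set
  InW W h = W (proj₁ h) ≡ true

  degW : EdgeSet → EdgeSet → Fin nE → ℕ
  degW F W e = countH (λ h → W (proj₁ h) ∧ atXᵇ F e h)

  Degrees2or4 : EdgeSet → EdgeSet → Set
  Degrees2or4 F W = ∀ e → F e ≡ true → degW F W e ≡ 2 ⊎ degW F W e ≡ 4

  Admissible : EdgeSet → EdgeSet → Set
  Admissible F W = ∀ e → F e ≡ true → degW F W e ≡ 2 →
    ∀ h₁ h₂ → h₁ ≢ h₂ → InW W h₁ → InW W h₂ → AtX F e h₁ → AtX F e h₂ →
    Traversing e h₁ h₂

  DifferentColorsAtDeg2 : EdgeSet → EdgeSet → (Fin nE → Bool) → Set
  DifferentColorsAtDeg2 F W col = ∀ e → F e ≡ true → degW F W e ≡ 2 →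
    Σ HalfEdge λ h₁ → Σ HalfEdge λ h₂ →
      InW W h₁ × InW W h₂ × AtX F e h₁ × AtX F e h₂ ×
      col (proj₁ h₁) ≢ col (proj₁ h₂)

-- Only the compatibility of the colouring with the transitions is needed:
-- at a vertex x_e of W-degree 2 the edge-ends of W form a single transition
-- {a, b}, and compatibility says that {a, b} is traversing exactly when it is
-- colour-switching.
module Submission where

open import Defs
open import Data.Bool using (Bool; true; T; T?; _∧_)
open import Data.Bool.Properties using (T-≡; T-not-≡; T-∧; T-∨)
open import Data.Fin using (Fin; _≟_)
open import Data.List using (List; []; _∷_; length; filterᵇ)
open import Data.List.Membership.Propositional using (_∈_)
open import Data.List.Membership.Propositional.Properties
  using (∈-cartesianProduct⁺; ∈-allFin; ∈-filter⁺; ∈-filter⁻)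
open import Data.List.Relation.Unary.Any using (here; there)
open import Data.List.Relation.Unary.All using ([]; _∷_)
open import Data.List.Relation.Unary.AllPairs using ([]; _∷_)
open import Data.List.Relation.Unary.Unique.Propositional using (Unique)
import Data.List.Relation.Unary.Unique.Propositional.Properties as Unique
open import Data.Product using (_×_; _,_; proj₁; proj₂)
open import Data.Product.Function.NonDependent.Propositional using (_×-⇔_)
open import Data.Sum using (_⊎_; inj₁; inj₂)
open import Data.Sum.Function.Propositional using (_⊎-⇔_)
open import Data.Empty using (⊥-elim)
open import Function using (_∘_)
open import Function.Bundles using (_⇔_; mk⇔; Equivalence)
open import Function.Construct.Composition using (_⇔-∘_)
open import Relation.Nullary.Decidable using (Dec; ⌊_⌋; toWitness; fromWitness)
open import Relation.Binary.PropositionalEquality using (_≡_; _≢_; refl; sym; cong)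

record ExactlyTwo {A : Set} (P : A → Set) : Set where
  constructor exactlyTwo
  field
    fst snd : A
    distinct : fst ≢ snd
    fst-ok : P fst
    snd-ok : P snd
    only : ∀ x → P x → x ≡ fst ⊎ x ≡ snd

unique-length-two : ∀ {A : Set} (xs : List A) → Unique xs → length xs ≡ 2 →
  ExactlyTwo (_∈ xs)
unique-length-two (a ∷ b ∷ []) ((a≢b ∷ []) ∷ _) refl =
  exactlyTwo a b a≢b (here refl) (there (here refl)) member
  where
  member : ∀ x → x ∈ a ∷ b ∷ [] → x ≡ a ⊎ x ≡ b
  member x (here x≡a)          = inj₁ x≡a
  member x (there (here x≡b))  = inj₂ x≡b
  member x (there (there ()))

distinct-pair : ∀ {A : Set} {P : A → Set} (two : ExactlyTwo P) {x y : A} →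
  x ≢ y → P x → P y →
  (x ≡ ExactlyTwo.fst two × y ≡ ExactlyTwo.snd two) ⊎
  (x ≡ ExactlyTwo.snd two × y ≡ ExactlyTwo.fst two)
distinct-pair (exactlyTwo a b _ _ _ only) {x} {y} x≢y Px Py
  with only x Px | only y Py
... | inj₁ refl | inj₁ refl = ⊥-elim (x≢y refl)
... | inj₁ refl | inj₂ refl = inj₁ (refl , refl)
... | inj₂ refl | inj₁ refl = inj₂ (refl , refl)
... | inj₂ refl | inj₂ refl = ⊥-elim (x≢y refl)

symmetric-on-pair : ∀ {A : Set} {P : A → Set} (R : A → A → Set) →
  (∀ {x y} → R x y → R y x) →
  (two : ExactlyTwo P) → ∀ {x y u v} →
  u ≢ v → P u → P v → R u v →
  x ≢ y → P x → P y → R x y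
symmetric-on-pair R R-sym two u≢v Pu Pv Ruv x≢y Px Py
  with distinct-pair two u≢v Pu Pv | distinct-pair two x≢y Px Py
... | inj₁ (refl , refl) | inj₁ (refl , refl) = Ruv
... | inj₁ (refl , refl) | inj₂ (refl , refl) = R-sym Ruv
... | inj₂ (refl , refl) | inj₁ (refl , refl) = R-sym Ruv
... | inj₂ (refl , refl) | inj₂ (refl , refl) = Ruv

T-⌊⌋ : ∀ {P : Set} (P? : Dec P) → T ⌊ P? ⌋ ⇔ P
T-⌊⌋ P? = mk⇔ toWitness fromWitness

module _ (G : Multigraph) where
  open Multigraph G

  halfEdges-unique : Unique (halfEdges G)
  halfEdges-unique = Unique.cartesianProduct⁺ (Unique.allFin⁺ nE) (Unique.allFin⁺ 2)

  halfEdges-complete : ∀ h → h ∈ halfEdges G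
  halfEdges-complete (g , s) = ∈-cartesianProduct⁺ (∈-allFin g) (∈-allFin s)

  countH-two : (p : HalfEdge G → Bool) → countH G p ≡ 2 → ExactlyTwo (T ∘ p)
  countH-two p count≡2
    with unique-length-two (filterᵇ p (halfEdges G))
           (Unique.filter⁺ (T? ∘ p) halfEdges-unique) count≡2
  ... | exactlyTwo a b a≢b a∈ b∈ only =
    exactlyTwo a b a≢b (passes a∈) (passes b∈)
      (λ h ph → only h (∈-filter⁺ (T? ∘ p) (halfEdges-complete h) ph))
    where
    passes : ∀ {h} → h ∈ filterᵇ p (halfEdges G) → T (p h)
    passes h∈ = proj₂ (∈-filter⁻ (T? ∘ p) {xs = halfEdges G} h∈)

  inW-atX⇔ : (F W : EdgeSet G) (e : Fin nE) (h : HalfEdge G) →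
    T (W (proj₁ h) ∧ atXᵇ G F e h) ⇔ (InW G W h × AtX G F e h)
  inW-atX⇔ F W e h =
    (T-≡ ×-⇔ ((T-not-≡ ×-⇔ ((T-⌊⌋ (vtx G h ≟ end0 G e) ⊎-⇔ T-⌊⌋ (vtx G h ≟ end1 G e))
                            ⇔-∘ T-∨))
              ⇔-∘ T-∧))
    ⇔-∘ T-∧

  EndsInW : EdgeSet G → EdgeSet G → Fin nE → HalfEdge G → Set
  EndsInW F W e h = InW G W h × AtX G F e h

  degree-two-ends : (F W : EdgeSet G) (e : Fin nE) → degW G F W e ≡ 2 →
    ExactlyTwo (EndsInW F W e)
  degree-two-ends F W e deg≡2
    with countH-two (λ h → W (proj₁ h) ∧ atXᵇ G F e h) deg≡2
  ... | exactlyTwo a b a≢b ta tb only =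
    exactlyTwo a b a≢b (reflects ta) (reflects tb)
      (λ h inW → only h (Equivalence.from (inW-atX⇔ F W e h) inW))
    where
    reflects : ∀ {h} → T (W (proj₁ h) ∧ atXᵇ G F e h) → EndsInW F W e h
    reflects {h} = Equivalence.to (inW-atX⇔ F W e h)

proposition8 : (G : Multigraph) → Cubic G → Connected G →
    (F : EdgeSet G) → IsOneFactor G F → Special G F →
    (col : Fin (Multigraph.nE G) → Bool) →
    IsTwoFactorization G F col → Compatible G F col →
    (W : EdgeSet G) → IsSubgraphOfX G F W → Degrees2or4 G F W →
    Admissible G F W ⇔ DifferentColorsAtDeg2 G F W col
proposition8 G _ _ F _ _ col _ compatible W _ _ = mk⇔ admissible⇒colours colours⇒admissible
  where
  colour : HalfEdge G → Bool
  colour h = col (proj₁ h)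

  traversing⇔switching : ∀ {e} → F e ≡ true → ∀ {h₁ h₂} → h₁ ≢ h₂ →
    AtX G F e h₁ → AtX G F e h₂ →
    Traversing G e h₁ h₂ ⇔ ColorSwitching G col h₁ h₂
  traversing⇔switching Fe h₁≢h₂ at₁ at₂ = proj₁ (compatible _ Fe _ _ h₁≢h₂ at₁ at₂)

  admissible⇒colours : Admissible G F W → DifferentColorsAtDeg2 G F W col
  admissible⇒colours admissible e Fe deg≡2
    with degree-two-ends G F W e deg≡2
  ... | exactlyTwo a b a≢b (Wa , atA) (Wb , atB) _ =
    a , b , Wa , Wb , atA , atB ,
    Equivalence.to (traversing⇔switching Fe a≢b atA atB)
      (admissible e Fe deg≡2 a b a≢b Wa Wb atA atB)

  -- any W-transition at a degree-2 vertex is the witnessed switching one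
  colours⇒admissible : DifferentColorsAtDeg2 G F W col → Admissible G F W
  colours⇒admissible colours e Fe deg≡2 h₁ h₂ h₁≢h₂ W₁ W₂ at₁ at₂
    with colours e Fe deg≡2
  ... | k₁ , k₂ , Wk₁ , Wk₂ , atk₁ , atk₂ , switching =
    Equivalence.from (traversing⇔switching Fe h₁≢h₂ at₁ at₂)
      (symmetric-on-pair (λ x y → colour x ≢ colour y) (λ ne eq → ne (sym eq))
        (degree-two-ends G F W e deg≡2)
        (λ k₁≡k₂ → switching (cong colour k₁≡k₂))
        (Wk₁ , atk₁) (Wk₂ , atk₂) switching
        h₁≢h₂ (W₁ , at₁) (W₂ , at₂))
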